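{- There is no graph $F$ and no function $N:\mathbb N\to\textsc{Graph}$ such that for all graphs $G$ and $H$: if $n_0:=\hom(F,G)=\hom(F,H)$ and $\hom(N(n_0),G)=\hom(N(n_0),H)$, then $G\cong H$.
   Context: Graphs are finite, simple, undirected, with non-empty vertex set; $\textsc{Graph}$ is the class of all graphs. $\hom(F,G)$ denotes the number of homomorphisms from $F$ to $G$. -}

module Defs where

open import Data.Nat using (ℕ; zero; suc; _+_; NonZero)
open import Data.Fin using (Fin; zero; suc)
open import Data.Bool using (Bool; true; false; T; not; _∧_)
open import Data.List using (List; []; _∷_; map; concatMap; length; filterᵇ; allFin)
open import Data.Product using (Σ; _×_; _,_)
open import Relation.Binary.PropositionalEquality using (_≡_)
open import Function.Bundles using (_↔_; Inverse)

record Graph : Set where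
  field
    size     : ℕ
    nonEmpty : NonZero size
    adj      : Fin size → Fin size → Bool
    symm     : ∀ u v → adj u v ≡ adj v u
    irrefl   : ∀ v → adj v v ≡ false

open Graph public

allMaps : (k n : ℕ) → List (Fin k → Fin n)
allMaps zero    n = (λ ()) ∷ []
allMaps (suc k) n =
  concatMap (λ f → map (λ a → λ { zero → a ; (suc i) → f i }) (allFin n)) (allMaps k n)

allᵇ : (k : ℕ) → (Fin k → Bool) → Bool
allᵇ zero    p = true
allᵇ (suc k) p = p zero ∧ allᵇ k (λ i → p (suc i))

_⇒ᵇ_ : Bool → Bool → Bool
true  ⇒ᵇ b = b
false ⇒ᵇ b = true

isHomᵇ : (F G : Graph) → (Fin (size F) → Fin (size G)) → Bool
isHomᵇ F G f =
  allᵇ (size F) (λ u → allᵇ (size F) (λ v → adj F u v ⇒ᵇ adj G (f u) (f v)))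

hom : Graph → Graph → ℕ
hom F G = length (filterᵇ (isHomᵇ F G) (allMaps (size F) (size G)))

_≅_ : Graph → Graph → Set
G ≅ H = Σ (Fin (size G) ↔ Fin (size H)) λ φ →
          ∀ u v → adj G u v ≡ adj H (Inverse.to φ u) (Inverse.to φ v)

-- If F is not bipartite, hom(F, G) = 0 for every bipartite G, so the single graph N(0) would have
-- to separate all bipartite graphs. But if N(0) has an edge it has no homomorphisms into any edgeless
-- graph, and if it is edgeless it counts |V(G)|^|V(N(0))| homomorphisms into every G; either way two
-- non-isomorphic bipartite graphs are not separated.
--
-- If F is bipartite, swapping the two sheets of X × K₂ over one colour class of a bipartite K shows
-- hom(K, X × K₂) = hom(K, X ⊕ X). Let X_σ, for σ ⊆ {0, …, r - 1}, be a triangle together with r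
-- stars whose centres have distinct degrees ≥ 3, the i-th star having its edges exactly when i ∈ σ.
-- These graphs have O(r²) vertices, so hom(F, X_σ × K₂) takes polynomially many values on 2^r sets σ,
-- and two covers X_σ × K₂, X_τ × K₂ with σ ≠ τ share a value n₀. If N(n₀) is bipartite it does not
-- separate X_σ × K₂ from the non-bipartite X_σ ⊕ X_σ; otherwise it has no homomorphisms into
-- either cover, although the covers have different degree sets.

module Submission where

open import Defs
open import Data.Nat using (ℕ; zero; suc; _+_; _*_; _^_; _≤_; _<_; z≤n; s≤s; NonZero; _≟_)
open import Data.Nat.Properties
open import Data.Nat.Tactic.RingSolver using (solve-∀)
open import Data.Nat.ListAction using () renaming (sum to sumˡ)
open import Data.Nat.ListAction.Properties using (sum-++)
open import Data.Fin using (Fin; zero; suc; splitAt; _↑ˡ_; _↑ʳ_; toℕ; fromℕ<; combine; finToFun; funToFin)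
  renaming (_≟_ to _≟ᶠ_)
open import Data.Fin.Properties
  using (2↔Bool; funToFin-finToFin; toℕ-fromℕ<; splitAt-↑ˡ; splitAt-↑ʳ; splitAt⁻¹-↑ˡ; splitAt⁻¹-↑ʳ; splitAt-join; +↔⊎; pigeonhole)
import Data.Fin.Properties as Fin
open import Data.Bool using (Bool; true; false; T; not; _∧_)
open import Data.Bool.Properties using (T-∧; ⇔→≡)
open import Data.List as List using (List; map; concatMap; length; filterᵇ; allFin)
open import Data.List.Properties using (map-++; map-tabulate; map-cong; map-∘)
open import Data.Product using (Σ; ∃; _×_; _,_; proj₁; proj₂)
open import Data.Sum using (_⊎_; inj₁; inj₂; [_,_]; swap)
import Data.Sum as Sum
open import Data.Sum.Properties using (swap-↔)
open import Data.Vec.Functional using (Vector; []; _∷_)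
open import Data.Fin.Permutation using (Permutation′; _⟨$⟩ʳ_; _⟨$⟩ˡ_; ↔⇒≡)
open import Function using (_∘_; id; const; case_of_; _⇔_; mk⇔; Equivalence; Inverse)
open import Function.Properties.Inverse using (↔-refl; ↔-sym; ↔-trans)
open import Function.Construct.Composition using (_⇔-∘_)
open import Function.Construct.Symmetry using (⇔-sym)
open import Relation.Binary.Core using (_Preserves_⟶_)
open import Relation.Nullary using (¬_; Dec; yes; no; does)
open import Relation.Nullary.Decidable using (dec-true; dec-false)
open import Data.Empty using (⊥; ⊥-elim)
open import Relation.Binary.PropositionalEquality
  using (_≡_; _≢_; _≗_; refl; sym; trans; cong; cong₂; subst; module ≡-Reasoning)
open import Algebra.Properties.CommutativeMonoid.Sum +-0-commutativeMonoid
  using (sum; sum-syntax; sum-cong-≗; sum-permute; sum-remove)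

𝟙 : Bool → ℕ
𝟙 true  = 1
𝟙 false = 0

𝟙≤1 : ∀ b → 𝟙 b ≤ 1
𝟙≤1 true  = s≤s z≤n
𝟙≤1 false = z≤n

sum-const : ∀ n c → ∑[ i < n ] c ≡ n * c
sum-const zero    c = refl
sum-const (suc n) c = cong (c +_) (sum-const n c)

sum-zero : ∀ n → ∑[ i < n ] 0 ≡ 0
sum-zero n = trans (sum-const n 0) (*-zeroʳ n)

≤-sum : ∀ {n} (f : Fin n → ℕ) i → f i ≤ sum f
≤-sum {suc n} f i = ≤-trans (m≤m+n (f i) _) (≤-reflexive (sym (sum-remove f)))

sum-mono-≤ : ∀ {n} {f g : Fin n → ℕ} → (∀ i → f i ≤ g i) → sum f ≤ sum g
sum-mono-≤ {zero}  f≤g = z≤n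
sum-mono-≤ {suc n} f≤g = +-mono-≤ (f≤g zero) (sum-mono-≤ (f≤g ∘ suc))

sum-↑ : ∀ m {n} (f : Fin (m + n) → ℕ) → sum f ≡ sum (f ∘ (_↑ˡ n)) + sum (f ∘ (m ↑ʳ_))
sum-↑ zero    f = refl
sum-↑ (suc m) f = trans (cong (f zero +_) (sum-↑ m (f ∘ suc))) (sym (+-assoc (f zero) _ _))

sum-splitAt : ∀ m {n} (h : Fin m ⊎ Fin n → ℕ) → sum (h ∘ splitAt m) ≡ sum (h ∘ inj₁) + sum (h ∘ inj₂)
sum-splitAt m {n} h = trans (sum-↑ m (h ∘ splitAt m))
  (cong₂ _+_ (sum-cong-≗ (λ i → cong h (splitAt-↑ˡ m i n)))
             (sum-cong-≗ (λ j → cong h (splitAt-↑ʳ m n j))))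

sum-pos : ∀ {n} (f : Fin n → ℕ) → 0 < sum f → ∃ λ i → 0 < f i
sum-pos {suc n} f pos with f zero in eq
... | suc _ = zero , subst (0 <_) (sym eq) (s≤s z≤n)
... | zero  = let i , fi>0 = sum-pos (f ∘ suc) pos in suc i , fi>0

-- Sums over all maps Fin k → Fin m

sumMaps : ∀ k m → (Vector (Fin m) k → ℕ) → ℕ
sumMaps zero    m w = w []
sumMaps (suc k) m w = sumMaps k m (λ g → ∑[ a < m ] w (a ∷ g))

module _ {m : ℕ} where

  ∷-η : ∀ {k} (f : Vector (Fin m) (suc k)) → f ≗ f zero ∷ (f ∘ suc)
  ∷-η f zero    = refl
  ∷-η f (suc i) = refl

  ∷-respects-≗ : ∀ {k} (w : Vector (Fin m) (suc k) → ℕ) → w Preserves _≗_ ⟶ _≡_ →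
                 (λ g → ∑[ a < m ] w (a ∷ g)) Preserves _≗_ ⟶ _≡_
  ∷-respects-≗ w w-ext {g} {h} g≗h =
    sum-cong-≗ λ a → w-ext {a ∷ g} {a ∷ h} λ { zero → refl ; (suc i) → g≗h i }

  sumMaps-cong : ∀ k {w w′ : Vector (Fin m) k → ℕ} → (∀ f → w f ≡ w′ f) → sumMaps k m w ≡ sumMaps k m w′
  sumMaps-cong zero    w≡w′ = w≡w′ []
  sumMaps-cong (suc k) w≡w′ = sumMaps-cong k λ g → sum-cong-≗ λ a → w≡w′ (a ∷ g)

  sumMaps-mono-≤ : ∀ k {w w′ : Vector (Fin m) k → ℕ} → (∀ f → w f ≤ w′ f) → sumMaps k m w ≤ sumMaps k m w′
  sumMaps-mono-≤ zero    w≤w′ = w≤w′ []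
  sumMaps-mono-≤ (suc k) w≤w′ = sumMaps-mono-≤ k λ g → sum-mono-≤ λ a → w≤w′ (a ∷ g)

  sumMaps-const : ∀ k c → sumMaps k m (const c) ≡ m ^ k * c
  sumMaps-const zero    c = sym (+-identityʳ c)
  sumMaps-const (suc k) c = begin
    sumMaps k m (const (∑[ a < m ] c)) ≡⟨ sumMaps-cong k (λ _ → sum-const m c) ⟩
    sumMaps k m (const (m * c))        ≡⟨ sumMaps-const k (m * c) ⟩
    m ^ k * (m * c)                    ≡⟨ sym (*-assoc (m ^ k) m c) ⟩
    m ^ k * m * c                      ≡⟨ cong (_* c) (*-comm (m ^ k) m) ⟩
    m * m ^ k * c                      ∎
    where open ≡-Reasoning

  ≤-sumMaps : ∀ k (w : Vector (Fin m) k → ℕ) → w Preserves _≗_ ⟶ _≡_ → ∀ f → w f ≤ sumMaps k m w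
  ≤-sumMaps zero    w w-ext f = ≤-reflexive (w-ext (λ ()))
  ≤-sumMaps (suc k) w w-ext f = begin
    w f                                  ≡⟨ w-ext (∷-η f) ⟩
    w (f zero ∷ (f ∘ suc))               ≤⟨ ≤-sum (λ a → w (a ∷ (f ∘ suc))) (f zero) ⟩
    ∑[ a < m ] w (a ∷ (f ∘ suc))         ≤⟨ ≤-sumMaps k _ (∷-respects-≗ w w-ext) (f ∘ suc) ⟩
    sumMaps (suc k) m w                  ∎
    where open ≤-Reasoning

  sumMaps-pos : ∀ k (w : Vector (Fin m) k → ℕ) → 0 < sumMaps k m w → ∃ λ f → 0 < w f
  sumMaps-pos zero    w pos = [] , pos
  sumMaps-pos (suc k) w pos =
    let g , g-pos = sumMaps-pos k _ pos
        a , a-pos = sum-pos (λ a → w (a ∷ g)) g-pos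
    in a ∷ g , a-pos

  sumMaps-permute : ∀ k (π : Fin k → Permutation′ m) (w : Vector (Fin m) k → ℕ) → w Preserves _≗_ ⟶ _≡_ →
                    sumMaps k m (λ f → w (λ u → π u ⟨$⟩ʳ f u)) ≡ sumMaps k m w
  sumMaps-permute zero    π w w-ext = w-ext (λ ())
  sumMaps-permute (suc k) π w w-ext = begin
    sumMaps k m (λ g → ∑[ a < m ] w (λ u → π u ⟨$⟩ʳ (a ∷ g) u))
      ≡⟨ sumMaps-cong k (λ g → sum-cong-≗ λ a → w-ext (∷-η (λ u → π u ⟨$⟩ʳ (a ∷ g) u))) ⟩
    sumMaps k m (λ g → ∑[ a < m ] w ((π zero ⟨$⟩ʳ a) ∷ (λ u → π (suc u) ⟨$⟩ʳ g u)))
      ≡⟨ sumMaps-cong k (λ g → sym (sum-permute (λ b → w (b ∷ (λ u → π (suc u) ⟨$⟩ʳ g u))) (π zero))) ⟩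
    sumMaps k m (λ g → ∑[ b < m ] w (b ∷ (λ u → π (suc u) ⟨$⟩ʳ g u)))
      ≡⟨ sumMaps-permute k (π ∘ suc) _ (∷-respects-≗ w w-ext) ⟩
    sumMaps (suc k) m w ∎
    where open ≡-Reasoning

length-filterᵇ : ∀ {A : Set} (p : A → Bool) (xs : List A) → length (filterᵇ p xs) ≡ sumˡ (map (𝟙 ∘ p) xs)
length-filterᵇ p List.[]       = refl
length-filterᵇ p (x List.∷ xs) with p x
... | true  = cong suc (length-filterᵇ p xs)
... | false = length-filterᵇ p xs

sum-map-concatMap : ∀ {A B : Set} (h : A → List B) (w : B → ℕ) (xs : List A) →
                    sumˡ (map w (concatMap h xs)) ≡ sumˡ (map (λ x → sumˡ (map w (h x))) xs)
sum-map-concatMap h w List.[]       = refl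
sum-map-concatMap h w (x List.∷ xs) = begin
  sumˡ (map w (h x List.++ concatMap h xs))          ≡⟨ cong sumˡ (map-++ w (h x) _) ⟩
  sumˡ (map w (h x) List.++ map w (concatMap h xs))  ≡⟨ sum-++ (map w (h x)) _ ⟩
  sumˡ (map w (h x)) + sumˡ (map w (concatMap h xs)) ≡⟨ cong (_ +_) (sum-map-concatMap h w xs) ⟩
  sumˡ (map w (h x)) + sumˡ (map (λ x → sumˡ (map w (h x))) xs) ∎
  where open ≡-Reasoning

sumˡ-tabulate : ∀ {n} (f : Fin n → ℕ) → sumˡ (List.tabulate f) ≡ sum f
sumˡ-tabulate {zero}  f = refl
sumˡ-tabulate {suc n} f = cong (f zero +_) (sumˡ-tabulate (f ∘ suc))

sum-map-allFin : ∀ {n} (f : Fin n → ℕ) → sumˡ (map f (allFin n)) ≡ sum f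
sum-map-allFin f = trans (cong sumˡ (map-tabulate (λ i → i) f)) (sumˡ-tabulate f)

-- allMaps extends maps by its own pattern lambda, which agrees with _∷_ only pointwise;
-- hence the hypothesis on w.
sum-map-allMaps : ∀ k m (w : Vector (Fin m) k → ℕ) → w Preserves _≗_ ⟶ _≡_ →
                  sumˡ (map w (allMaps k m)) ≡ sumMaps k m w
sum-map-allMaps zero    m w w-ext = trans (+-identityʳ _) (w-ext (λ ()))
sum-map-allMaps (suc k) m w w-ext =
  trans (sum-map-concatMap _ w (allMaps k m))
  (trans (cong sumˡ (map-cong (λ g → sum-extensions g _ λ a → λ { zero → refl ; (suc i) → refl }) (allMaps k m)))
         (sum-map-allMaps k m _ (∷-respects-≗ w w-ext)))
  where
  sum-extensions : ∀ g (c : Fin m → Vector (Fin m) (suc k)) → (∀ a → c a ≗ a ∷ g) →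
                   sumˡ (map w (map c (allFin m))) ≡ ∑[ a < m ] w (a ∷ g)
  sum-extensions g c c≗ = begin
    sumˡ (map w (map c (allFin m))) ≡⟨ cong sumˡ (sym (map-∘ (allFin m))) ⟩
    sumˡ (map (w ∘ c) (allFin m))   ≡⟨ sum-map-allFin (w ∘ c) ⟩
    ∑[ a < m ] w (c a)              ≡⟨ sum-cong-≗ (λ a → w-ext (c≗ a)) ⟩
    ∑[ a < m ] w (a ∷ g)            ∎
    where open ≡-Reasoning

-- Homomorphisms

allᵇ-cong : ∀ k {p q : Fin k → Bool} → p ≗ q → allᵇ k p ≡ allᵇ k q
allᵇ-cong zero    p≗q = refl
allᵇ-cong (suc k) p≗q = cong₂ _∧_ (p≗q zero) (allᵇ-cong k (p≗q ∘ suc))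

T-allᵇ : ∀ k {p : Fin k → Bool} → T (allᵇ k p) ⇔ (∀ i → T (p i))
T-allᵇ zero    = mk⇔ (λ _ ()) (λ _ → _)
T-allᵇ (suc k) = mk⇔
  (λ all → let p₀ , rest = Equivalence.to T-∧ all in
           λ { zero → p₀ ; (suc i) → Equivalence.to (T-allᵇ k) rest i })
  (λ all → Equivalence.from T-∧ (all zero , Equivalence.from (T-allᵇ k) (all ∘ suc)))

T-⇒ᵇ : ∀ {a b} → T (a ⇒ᵇ b) ⇔ (T a → T b)
T-⇒ᵇ {true}  = mk⇔ (λ b _ → b) (λ f → f _)
T-⇒ᵇ {false} = mk⇔ (λ _ ()) (λ _ → _)

IsHom : (F G : Graph) → (Fin (size F) → Fin (size G)) → Set
IsHom F G f = ∀ u v → T (adj F u v) → T (adj G (f u) (f v))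

record Hom (F G : Graph) : Set where
  constructor mkHom
  field
    fun       : Fin (size F) → Fin (size G)
    preserves : IsHom F G fun

Hom-id : ∀ {G} → Hom G G
Hom-id = mkHom (λ v → v) (λ u v uv → uv)

Hom-∘ : ∀ {F G H} → Hom G H → Hom F G → Hom F H
Hom-∘ (mkHom g g-hom) (mkHom f f-hom) = mkHom (g ∘ f) λ u v → g-hom (f u) (f v) ∘ f-hom u v

≅⇒Hom⁻¹ : ∀ {G H} → G ≅ H → Hom H G
≅⇒Hom⁻¹ {G} {H} (φ , φ-adj) = mkHom (φ ⟨$⟩ˡ_) λ u v uv →
  subst T (sym (trans (φ-adj (φ ⟨$⟩ˡ u) (φ ⟨$⟩ˡ v))
                      (cong₂ (adj H) (Inverse.strictlyInverseˡ φ u) (Inverse.strictlyInverseˡ φ v)))) uv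

≅⇒size≡ : ∀ {G H} → G ≅ H → size G ≡ size H
≅⇒size≡ (φ , _) = ↔⇒≡ φ

T-isHomᵇ : ∀ F G f → T (isHomᵇ F G f) ⇔ IsHom F G f
T-isHomᵇ F G f = mk⇔
  (λ h u v → Equivalence.to T-⇒ᵇ (Equivalence.to (T-allᵇ (size F)) (Equivalence.to (T-allᵇ (size F)) h u) v))
  (λ h → Equivalence.from (T-allᵇ (size F)) λ u →
         Equivalence.from (T-allᵇ (size F)) λ v → Equivalence.from T-⇒ᵇ (h u v))

isHomᵇ-cong : ∀ F {G H} (f : Fin (size F) → Fin (size G)) (g : Fin (size F) → Fin (size H)) →
              (∀ u v → T (adj F u v) → adj G (f u) (f v) ≡ adj H (g u) (g v)) →
              isHomᵇ F G f ≡ isHomᵇ F H g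
isHomᵇ-cong F f g same = allᵇ-cong (size F) λ u → allᵇ-cong (size F) λ v → ⇒ᵇ-cong u v (adj F u v) refl
  where
  ⇒ᵇ-cong : ∀ u v b → adj F u v ≡ b → (b ⇒ᵇ _) ≡ (b ⇒ᵇ _)
  ⇒ᵇ-cong u v true  uv = same u v (subst T (sym uv) _)
  ⇒ᵇ-cong u v false uv = refl

isHomᵇ-respects-≗ : ∀ {F G} → (𝟙 ∘ isHomᵇ F G) Preserves _≗_ ⟶ _≡_
isHomᵇ-respects-≗ {F} {G} {f} {g} f≗g =
  cong 𝟙 (isHomᵇ-cong F {G} {G} f g λ u v _ → cong₂ (adj G) (f≗g u) (f≗g v))

hom-sumMaps : ∀ F G → hom F G ≡ sumMaps (size F) (size G) (𝟙 ∘ isHomᵇ F G)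
hom-sumMaps F G = trans (length-filterᵇ (isHomᵇ F G) (allMaps (size F) (size G)))
  (sum-map-allMaps (size F) (size G) _ (isHomᵇ-respects-≗ {F} {G}))

𝟙-T : ∀ {b} → T b → 𝟙 b ≡ 1
𝟙-T {true} _ = refl

𝟙-pos⁻¹ : ∀ {b} → 0 < 𝟙 b → T b
𝟙-pos⁻¹ {true} _ = _

hom-pos : ∀ {F G} → Hom F G → 0 < hom F G
hom-pos {F} {G} (mkHom f f-hom) = begin-strict
  0                                               <⟨ s≤s z≤n ⟩
  1                                               ≡⟨ 𝟙-T (Equivalence.from (T-isHomᵇ F G f) f-hom) ⟨
  𝟙 (isHomᵇ F G f)                                ≤⟨ ≤-sumMaps (size F) _ (isHomᵇ-respects-≗ {F} {G}) f ⟩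
  sumMaps (size F) (size G) (𝟙 ∘ isHomᵇ F G)      ≡⟨ sym (hom-sumMaps F G) ⟩
  hom F G                                         ∎
  where open ≤-Reasoning

hom-witness : ∀ {F G} → 0 < hom F G → Hom F G
hom-witness {F} {G} pos =
  let f , f-pos = sumMaps-pos (size F) _ (subst (0 <_) (hom-sumMaps F G) pos)
  in mkHom f (Equivalence.to (T-isHomᵇ F G f) (𝟙-pos⁻¹ f-pos))

hom≡0-∘ : ∀ F {G H} → Hom G H → hom F H ≡ 0 → hom F G ≡ 0
hom≡0-∘ F g hom[F,H]≡0 = n≤0⇒n≡0 (≮⇒≥ λ pos →
  <⇒≢ (hom-pos {F} (Hom-∘ g (hom-witness pos))) (sym hom[F,H]≡0))

hom≤ : ∀ F G → hom F G ≤ size G ^ size F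
hom≤ F G = begin
  hom F G                                       ≡⟨ hom-sumMaps F G ⟩
  sumMaps (size F) (size G) (𝟙 ∘ isHomᵇ F G)    ≤⟨ sumMaps-mono-≤ (size F) (𝟙≤1 ∘ isHomᵇ F G) ⟩
  sumMaps (size F) (size G) (const 1)           ≡⟨ sumMaps-const (size F) 1 ⟩
  size G ^ size F * 1                           ≡⟨ *-identityʳ _ ⟩
  size G ^ size F                               ∎
  where open ≤-Reasoning

Edgeless : Graph → Set
Edgeless G = ∀ u v → ¬ T (adj G u v)

Hom-Edgeless : ∀ {F G} → Hom F G → Edgeless G → Edgeless F
Hom-Edgeless (mkHom f f-hom) G-edgeless u v = G-edgeless (f u) (f v) ∘ f-hom u v

Edgeless⇒Hom : ∀ G → Edgeless G → ∀ H → Fin (size H) → Hom G H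
Edgeless⇒Hom G G-edgeless H v = mkHom (const v) λ u w uw → ⊥-elim (G-edgeless u w uw)

hom-Edgeless : ∀ F G → Edgeless F → hom F G ≡ size G ^ size F
hom-Edgeless F G F-edgeless = begin
  hom F G                                       ≡⟨ hom-sumMaps F G ⟩
  sumMaps (size F) (size G) (𝟙 ∘ isHomᵇ F G)    ≡⟨ sumMaps-cong (size F) every-map-is-hom ⟩
  sumMaps (size F) (size G) (const 1)           ≡⟨ sumMaps-const (size F) 1 ⟩
  size G ^ size F * 1                           ≡⟨ *-identityʳ _ ⟩
  size G ^ size F                               ∎
  where
  open ≡-Reasoning
  every-map-is-hom : ∀ f → 𝟙 (isHomᵇ F G f) ≡ 1
  every-map-is-hom f = 𝟙-T (Equivalence.from (T-isHomᵇ F G f) λ u v uv → ⊥-elim (F-edgeless u v uv))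

adj⇒≢ : ∀ G {u v} → T (adj G u v) → u ≢ v
adj⇒≢ G {u} uv refl = subst T (irrefl G u) uv

complete : (n : ℕ) → {{NonZero n}} → Graph
complete n {{n≢0}} = record
  { size = n ; nonEmpty = n≢0 ; adj = λ u v → not (does (u ≟ᶠ v))
  ; symm = λ u v → cong not (≟-sym u v) ; irrefl = λ v → cong not (dec-true (v ≟ᶠ v) refl) }
  where
  ≟-sym : ∀ (u v : Fin n) → does (u ≟ᶠ v) ≡ does (v ≟ᶠ u)
  ≟-sym u v with u ≟ᶠ v | v ≟ᶠ u
  ... | yes _   | yes _   = refl
  ... | no  _   | no  _   = refl
  ... | yes u≡v | no  v≢u = ⊥-elim (v≢u (sym u≡v))
  ... | no  u≢v | yes v≡u = ⊥-elim (u≢v (sym v≡u))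

complete-adj : ∀ {n} {{_ : NonZero n}} {u v : Fin n} → u ≢ v → T (adj (complete n) u v)
complete-adj {u = u} {v} u≢v rewrite dec-false (u ≟ᶠ v) u≢v = _

edgeless : (n : ℕ) → {{NonZero n}} → Graph
edgeless n {{n≢0}} = record
  { size = n ; nonEmpty = n≢0 ; adj = λ _ _ → false ; symm = λ _ _ → refl ; irrefl = λ _ → refl }

edgeless-Edgeless : ∀ n {{_ : NonZero n}} → Edgeless (edgeless n)
edgeless-Edgeless n u v ()

Bipartite : Graph → Set
Bipartite G = Hom G (complete 2)

bipartite-or-hom≡0 : ∀ G → Bipartite G ⊎ hom G (complete 2) ≡ 0
bipartite-or-hom≡0 G with hom G (complete 2) ≟ 0
... | yes hom≡0 = inj₂ hom≡0
... | no  hom≢0 = inj₁ (hom-witness (n≢0⇒n>0 hom≢0))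

star : ℕ → Bool → Graph
star d b = record { size = suc d ; nonEmpty = _ ; adj = adjacency ; symm = symmetric ; irrefl = irreflexive }
  where
  adjacency : Fin (suc d) → Fin (suc d) → Bool
  adjacency zero    (suc _) = b
  adjacency (suc _) zero    = b
  adjacency _       _       = false
  symmetric : ∀ u v → adjacency u v ≡ adjacency v u
  symmetric zero    zero    = refl
  symmetric zero    (suc _) = refl
  symmetric (suc _) zero    = refl
  symmetric (suc _) (suc _) = refl
  irreflexive : ∀ v → adjacency v v ≡ false
  irreflexive zero    = refl
  irreflexive (suc _) = refl

nonZero-+ : ∀ {m} n → NonZero m → NonZero (m + n)
nonZero-+ {suc m} n _ = _

splitGraph : ∀ m n → NonZero m → (R : Fin m ⊎ Fin n → Fin m ⊎ Fin n → Bool) →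
             (∀ a b → R a b ≡ R b a) → (∀ a → R a a ≡ false) → Graph
splitGraph m n m≢0 R R-symm R-irrefl = record
  { size = m + n ; nonEmpty = nonZero-+ n m≢0
  ; adj = λ u v → R (splitAt m u) (splitAt m v)
  ; symm = λ u v → R-symm (splitAt m u) (splitAt m v)
  ; irrefl = λ v → R-irrefl (splitAt m v) }

⊕-adj : (A B : Graph) → Fin (size A) ⊎ Fin (size B) → Fin (size A) ⊎ Fin (size B) → Bool
⊕-adj A B (inj₁ x) (inj₁ y) = adj A x y
⊕-adj A B (inj₂ x) (inj₂ y) = adj B x y
⊕-adj A B _        _        = false

infixr 25 _⊕_
_⊕_ : Graph → Graph → Graph
A ⊕ B = splitGraph (size A) (size B) (nonEmpty A) (⊕-adj A B) symmetric irreflexive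
  where
  symmetric : ∀ a b → ⊕-adj A B a b ≡ ⊕-adj A B b a
  symmetric (inj₁ x) (inj₁ y) = symm A x y
  symmetric (inj₁ x) (inj₂ y) = refl
  symmetric (inj₂ x) (inj₁ y) = refl
  symmetric (inj₂ x) (inj₂ y) = symm B x y
  irreflexive : ∀ a → ⊕-adj A B a a ≡ false
  irreflexive (inj₁ x) = irrefl A x
  irreflexive (inj₂ x) = irrefl B x

cover-adj : (X : Graph) → Fin (size X) ⊎ Fin (size X) → Fin (size X) ⊎ Fin (size X) → Bool
cover-adj X (inj₁ x) (inj₂ y) = adj X x y
cover-adj X (inj₂ x) (inj₁ y) = adj X x y
cover-adj X _        _        = false

doubleCover : Graph → Graph
doubleCover X = splitGraph (size X) (size X) (nonEmpty X) (cover-adj X) symmetric irreflexive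
  where
  symmetric : ∀ a b → cover-adj X a b ≡ cover-adj X b a
  symmetric (inj₁ x) (inj₁ y) = refl
  symmetric (inj₁ x) (inj₂ y) = symm X x y
  symmetric (inj₂ x) (inj₁ y) = symm X x y
  symmetric (inj₂ x) (inj₂ y) = refl
  irreflexive : ∀ a → cover-adj X a a ≡ false
  irreflexive (inj₁ x) = refl
  irreflexive (inj₂ x) = refl

⊕-inj₁ : ∀ {A B} → Hom A (A ⊕ B)
⊕-inj₁ {A} {B} = mkHom (_↑ˡ size B) λ u v uv →
  subst T (sym (cong₂ (⊕-adj A B) (splitAt-↑ˡ (size A) u (size B)) (splitAt-↑ˡ (size A) v (size B)))) uv

¬Hom-complete : ∀ {m n} {{_ : NonZero m}} {{_ : NonZero n}} → n < m → ¬ Hom (complete m) (complete n)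
¬Hom-complete {n = n} n<m (mkHom f f-hom) =
  let i , j , i<j , fi≡fj = pigeonhole n<m f
  in adj⇒≢ (complete n) (f-hom i j (complete-adj (Fin.<⇒≢ i<j))) fi≡fj

doubleCover-bipartite : ∀ X → Bipartite (doubleCover X)
doubleCover-bipartite X = mkHom side preserves
  where
  side : Fin (size X + size X) → Fin 2
  side u = [ const zero , const (suc zero) ] (splitAt (size X) u)
  preserves : IsHom (doubleCover X) (complete 2) side
  preserves u v uv with splitAt (size X) u | splitAt (size X) v
  ... | inj₁ _ | inj₂ _ = _
  ... | inj₂ _ | inj₁ _ = _

-- Double covers and disjoint unions

swapHalves : ∀ n → Permutation′ (n + n)
swapHalves n = ↔-trans (+↔⊎ {n} {n}) (↔-trans swap-↔ (↔-sym +↔⊎))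

swapHalves^ : ∀ n → Fin 2 → Permutation′ (n + n)
swapHalves^ n zero       = ↔-refl
swapHalves^ n (suc zero) = swapHalves n

cover-adj-swapˡ : ∀ X a b → cover-adj X (swap a) b ≡ ⊕-adj X X a b
cover-adj-swapˡ X (inj₁ x) (inj₁ y) = refl
cover-adj-swapˡ X (inj₁ x) (inj₂ y) = refl
cover-adj-swapˡ X (inj₂ x) (inj₁ y) = refl
cover-adj-swapˡ X (inj₂ x) (inj₂ y) = refl

cover-adj-swapʳ : ∀ X a b → cover-adj X a (swap b) ≡ ⊕-adj X X a b
cover-adj-swapʳ X (inj₁ x) (inj₁ y) = refl
cover-adj-swapʳ X (inj₁ x) (inj₂ y) = refl
cover-adj-swapʳ X (inj₂ x) (inj₁ y) = refl
cover-adj-swapʳ X (inj₂ x) (inj₂ y) = refl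

doubleCover-adj-swap : ∀ X {c c′ : Fin 2} → c ≢ c′ → ∀ u v →
  adj (doubleCover X) (swapHalves^ (size X) c ⟨$⟩ʳ u) (swapHalves^ (size X) c′ ⟨$⟩ʳ v) ≡ adj (X ⊕ X) u v
doubleCover-adj-swap X {zero}     {zero}     c≢c′ u v = ⊥-elim (c≢c′ refl)
doubleCover-adj-swap X {suc zero} {suc zero} c≢c′ u v = ⊥-elim (c≢c′ refl)
doubleCover-adj-swap X {zero}     {suc zero} _    u v =
  trans (cong (cover-adj X (splitAt (size X) u)) (splitAt-join (size X) (size X) (swap (splitAt (size X) v))))
        (cover-adj-swapʳ X (splitAt (size X) u) (splitAt (size X) v))
doubleCover-adj-swap X {suc zero} {zero}     _    u v =
  trans (cong (λ a → cover-adj X a (splitAt (size X) v)) (splitAt-join (size X) (size X) (swap (splitAt (size X) u))))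
        (cover-adj-swapˡ X (splitAt (size X) u) (splitAt (size X) v))

hom-doubleCover : ∀ {K} X → Bipartite K → hom K (doubleCover X) ≡ hom K (X ⊕ X)
hom-doubleCover {K} X (mkHom κ κ-hom) = begin
  hom K (doubleCover X)
    ≡⟨ hom-sumMaps K (doubleCover X) ⟩
  sumMaps (size K) _ (𝟙 ∘ isHomᵇ K (doubleCover X))
    ≡⟨ sumMaps-permute (size K) π (𝟙 ∘ isHomᵇ K (doubleCover X)) (isHomᵇ-respects-≗ {K} {doubleCover X}) ⟨
  sumMaps (size K) _ (λ f → 𝟙 (isHomᵇ K (doubleCover X) (λ u → π u ⟨$⟩ʳ f u)))
    ≡⟨ sumMaps-cong (size K) (λ f → cong 𝟙 (isHomᵇ-cong K {doubleCover X} {X ⊕ X} (λ u → π u ⟨$⟩ʳ f u) f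
         λ u v uv → doubleCover-adj-swap X {κ u} {κ v} (adj⇒≢ (complete 2) (κ-hom u v uv)) (f u) (f v))) ⟩
  sumMaps (size K) _ (𝟙 ∘ isHomᵇ K (X ⊕ X))
    ≡⟨ hom-sumMaps K (X ⊕ X) ⟨
  hom K (X ⊕ X) ∎
  where
  open ≡-Reasoning
  π : Fin (size K) → Permutation′ (size X + size X)
  π u = swapHalves^ (size X) (κ u)

-- Degrees

degree : (G : Graph) → Fin (size G) → ℕ
degree G v = ∑[ w < size G ] 𝟙 (adj G v w)

HasDegree : Graph → ℕ → Set
HasDegree G d = ∃ λ v → degree G v ≡ d

degree-≅ : ∀ {G H} ((φ , φ-adj) : G ≅ H) v → degree H (φ ⟨$⟩ʳ v) ≡ degree G v
degree-≅ {G} {H} (φ , φ-adj) v = begin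
  ∑[ w < size H ] 𝟙 (adj H (φ ⟨$⟩ʳ v) w)             ≡⟨ sum-permute _ φ ⟩
  ∑[ w < size G ] 𝟙 (adj H (φ ⟨$⟩ʳ v) (φ ⟨$⟩ʳ w))   ≡⟨ sum-cong-≗ (λ w → cong 𝟙 (φ-adj v w)) ⟨
  ∑[ w < size G ] 𝟙 (adj G v w)                      ∎
  where open ≡-Reasoning

HasDegree-≅ : ∀ {G H d} → G ≅ H → HasDegree G d ⇔ HasDegree H d
HasDegree-≅ {G} {H} G≅H@(φ , _) = mk⇔
  (λ (v , dv) → φ ⟨$⟩ʳ v , trans (degree-≅ {G} {H} G≅H v) dv)
  (λ (w , dw) → φ ⟨$⟩ˡ w , trans (sym (degree-≅ {G} {H} G≅H (φ ⟨$⟩ˡ w)))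
                               (trans (cong (degree H) (Inverse.strictlyInverseˡ φ w)) dw))

∃-+ : ∀ m {n} {P : Fin (m + n) → Set} → ∃ P ⇔ (∃ (P ∘ (_↑ˡ n)) ⊎ ∃ (P ∘ (m ↑ʳ_)))
∃-+ m {n} {P} = mk⇔ to [ (λ (x , p) → x ↑ˡ n , p) , (λ (y , p) → m ↑ʳ y , p) ]
  where
  to : ∃ P → ∃ (P ∘ (_↑ˡ n)) ⊎ ∃ (P ∘ (m ↑ʳ_))
  to (u , p) with splitAt m u in eq
  ... | inj₁ x = inj₁ (x , subst P (sym (splitAt⁻¹-↑ˡ eq)) p)
  ... | inj₂ y = inj₂ (y , subst P (sym (splitAt⁻¹-↑ʳ eq)) p)

sum-adj-splitAt : ∀ m {n} (R : Fin m ⊎ Fin n → Fin m ⊎ Fin n → Bool) {u a} → splitAt m u ≡ a →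
  ∑[ w < m + n ] 𝟙 (R (splitAt m u) (splitAt m w))
    ≡ ∑[ y < m ] 𝟙 (R a (inj₁ y)) + ∑[ z < n ] 𝟙 (R a (inj₂ z))
sum-adj-splitAt m R refl = sum-splitAt m (𝟙 ∘ R _)

degree-⊕ˡ : ∀ A B x → degree (A ⊕ B) (x ↑ˡ size B) ≡ degree A x
degree-⊕ˡ A B x = trans (sum-adj-splitAt (size A) (⊕-adj A B) (splitAt-↑ˡ (size A) x (size B)))
                        (trans (cong (degree A x +_) (sum-zero (size B))) (+-identityʳ _))

degree-⊕ʳ : ∀ A B y → degree (A ⊕ B) (size A ↑ʳ y) ≡ degree B y
degree-⊕ʳ A B y = trans (sum-adj-splitAt (size A) (⊕-adj A B) (splitAt-↑ʳ (size A) (size B) y))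
                        (cong (_+ degree B y) (sum-zero (size A)))

degree-doubleCoverˡ : ∀ X x → degree (doubleCover X) (x ↑ˡ size X) ≡ degree X x
degree-doubleCoverˡ X x = trans (sum-adj-splitAt (size X) (cover-adj X) (splitAt-↑ˡ (size X) x (size X)))
                                (cong (_+ degree X x) (sum-zero (size X)))

degree-doubleCoverʳ : ∀ X y → degree (doubleCover X) (size X ↑ʳ y) ≡ degree X y
degree-doubleCoverʳ X y = trans (sum-adj-splitAt (size X) (cover-adj X) (splitAt-↑ʳ (size X) (size X) y))
                                (trans (cong (degree X y +_) (sum-zero (size X))) (+-identityʳ _))

HasDegree-⊕ : ∀ {A B d} → HasDegree (A ⊕ B) d ⇔ (HasDegree A d ⊎ HasDegree B d)
HasDegree-⊕ {A} {B} = mk⇔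
  (Sum.map (λ (x , dx) → x , trans (sym (degree-⊕ˡ A B x)) dx)
           (λ (y , dy) → y , trans (sym (degree-⊕ʳ A B y)) dy)
   ∘ Equivalence.to (∃-+ (size A)))
  [ (λ (x , dx) → x ↑ˡ size B , trans (degree-⊕ˡ A B x) dx)
  , (λ (y , dy) → size A ↑ʳ y , trans (degree-⊕ʳ A B y) dy) ]

HasDegree-doubleCover : ∀ {X d} → HasDegree (doubleCover X) d ⇔ HasDegree X d
HasDegree-doubleCover {X} = mk⇔
  ([ (λ (x , dx) → x , trans (sym (degree-doubleCoverˡ X x)) dx)
   , (λ (y , dy) → y , trans (sym (degree-doubleCoverʳ X y)) dy) ]
   ∘ Equivalence.to (∃-+ (size X)))
  (λ (x , dx) → x ↑ˡ size X , trans (degree-doubleCoverˡ X x) dx)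

HasDegree-star : ∀ {d b e} → HasDegree (star d b) e → e ≤ 1 ⊎ (e ≡ d × b ≡ true)
HasDegree-star {d} {true}  (zero  , de) = inj₂ (trans (sym de) (trans (sum-const d 1) (*-identityʳ d)) , refl)
HasDegree-star {d} {false} (zero  , de) = inj₁ (≤-trans (≤-reflexive (trans (sym de) (sum-zero d))) z≤n)
HasDegree-star {d} {b} {e} (suc i , de) = inj₁ (begin
  e                  ≡⟨ de ⟨
  𝟙 b + ∑[ j < d ] 0 ≡⟨ cong (𝟙 b +_) (sum-zero d) ⟩
  𝟙 b + 0            ≤⟨ +-monoˡ-≤ 0 (𝟙≤1 b) ⟩
  1                  ∎)
  where open ≤-Reasoning

HasDegree-star-≥2 : ∀ {d b e} → 2 ≤ e → HasDegree (star d b) e → e ≡ d × b ≡ true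
HasDegree-star-≥2 2≤e has-e = [ (λ e≤1 → ⊥-elim (<⇒≱ 2≤e e≤1)) , id ] (HasDegree-star has-e)

star-HasDegree : ∀ d → HasDegree (star d true) d
star-HasDegree d = zero , trans (sum-const d 1) (*-identityʳ d)

HasDegree-triangle : ∀ {e} → HasDegree (complete 3) e → e ≡ 2
HasDegree-triangle (zero           , de) = sym de
HasDegree-triangle (suc zero       , de) = sym de
HasDegree-triangle (suc (suc zero) , de) = sym de

-- Triangles with stars attached

triangleStars : ∀ {r} → (Fin r → Bool) → Graph
triangleStars {zero}  σ = complete 3
triangleStars {suc r} σ = triangleStars (σ ∘ suc) ⊕ star (r + 3) (σ zero)

starDegree : ∀ {r} → Fin r → ℕ
starDegree {suc r} zero    = r + 3
starDegree         (suc i) = starDegree i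

3≤starDegree : ∀ {r} (i : Fin r) → 3 ≤ starDegree i
3≤starDegree {suc r} zero    = m≤n+m 3 r
3≤starDegree         (suc i) = 3≤starDegree i

starDegree< : ∀ {r} (i : Fin r) → starDegree i < r + 3
starDegree< {suc r} zero    = n<1+n (r + 3)
starDegree< {suc r} (suc i) = m<n⇒m<1+n (starDegree< i)

HasDegree-triangleStars-< : ∀ {r} (σ : Fin r → Bool) {e} → HasDegree (triangleStars σ) e → e < r + 3
HasDegree-triangleStars-< {zero}  σ has-e = ≤-reflexive (cong suc (HasDegree-triangle has-e))
HasDegree-triangleStars-< {suc r} σ has-e =
  [ (λ has-e → m<n⇒m<1+n (HasDegree-triangleStars-< (σ ∘ suc) has-e))
  , (λ has-e → [ (λ e≤1 → s≤s (≤-trans e≤1 (≤-trans (s≤s z≤n) (m≤n+m 3 r))))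
                 , (λ (e≡ , _) → ≤-reflexive (cong suc e≡)) ]
                 (HasDegree-star has-e)) ]
  (Equivalence.to HasDegree-⊕ has-e)

triangleStars-HasDegree : ∀ {r} (σ : Fin r → Bool) i → HasDegree (triangleStars σ) (starDegree i) ⇔ σ i ≡ true
triangleStars-HasDegree {suc r} σ zero = mk⇔
  ([ (λ has → ⊥-elim (<-irrefl refl (HasDegree-triangleStars-< (σ ∘ suc) has)))
   , (λ has → proj₂ (HasDegree-star-≥2 (<⇒≤ (m≤n+m 3 r)) has)) ]
   ∘ Equivalence.to HasDegree-⊕)
  (λ σ₀ → Equivalence.from HasDegree-⊕
     (inj₂ (subst (λ b → HasDegree (star (r + 3) b) (r + 3)) (sym σ₀) (star-HasDegree (r + 3)))))
triangleStars-HasDegree {suc r} σ (suc i) = mk⇔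
  ([ Equivalence.to (triangleStars-HasDegree (σ ∘ suc) i)
   , (λ has → ⊥-elim (<-irrefl (proj₁ (HasDegree-star-≥2 (<⇒≤ (3≤starDegree i)) has)) (starDegree< i))) ]
   ∘ Equivalence.to HasDegree-⊕)
  (Equivalence.from HasDegree-⊕ ∘ inj₁ ∘ Equivalence.from (triangleStars-HasDegree (σ ∘ suc) i))

triangle-triangleStars : ∀ {r} (σ : Fin r → Bool) → Hom (complete 3) (triangleStars σ)
triangle-triangleStars {zero}  σ = Hom-id
triangle-triangleStars {suc r} σ = Hom-∘ ⊕-inj₁ (triangle-triangleStars (σ ∘ suc))

doubleCover-triangleStars-≅ : ∀ {r} {σ τ : Fin r → Bool} →
  doubleCover (triangleStars σ) ≅ doubleCover (triangleStars τ) → σ ≗ τ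
doubleCover-triangleStars-≅ {σ = σ} {τ} iso i = ⇔→≡
  (triangleStars-HasDegree τ i ⇔-∘ (HasDegree-doubleCover ⇔-∘
    (HasDegree-≅ {doubleCover (triangleStars σ)} {doubleCover (triangleStars τ)} iso ⇔-∘
      (⇔-sym HasDegree-doubleCover ⇔-∘ ⇔-sym (triangleStars-HasDegree σ i)))))

-- The cover is bipartite while X ⊕ X contains the triangle of X.
¬doubleCover≅⊕ : ∀ {X} → Hom (complete 3) X → ¬ doubleCover X ≅ X ⊕ X
¬doubleCover≅⊕ {X} triangle iso =
  ¬Hom-complete ≤-refl (Hom-∘ (doubleCover-bipartite X) (Hom-∘ (≅⇒Hom⁻¹ iso) (Hom-∘ ⊕-inj₁ triangle)))

-- Many covers, few homomorphism counts

size-triangleStars : ∀ {r} (σ : Fin r → Bool) → size (triangleStars σ) ≤ (r + 2) * (r + 2)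
size-triangleStars {zero}  σ = s≤s (s≤s (s≤s z≤n))
size-triangleStars {suc r} σ = begin
  size (triangleStars (σ ∘ suc)) + suc (r + 3)  ≤⟨ +-monoˡ-≤ (suc (r + 3)) (size-triangleStars (σ ∘ suc)) ⟩
  (r + 2) * (r + 2) + suc (r + 3)               ≤⟨ m≤m+n _ (r + 1) ⟩
  (r + 2) * (r + 2) + suc (r + 3) + (r + 1)     ≡⟨ square-step r ⟩
  (suc r + 2) * (suc r + 2)                     ∎
  where
  open ≤-Reasoning
  square-step : ∀ r → (r + 2) * (r + 2) + suc (r + 3) + (r + 1) ≡ (suc r + 2) * (suc r + 2)
  square-step = solve-∀

size-doubleCover-triangleStars : ∀ {r} (σ : Fin r → Bool) → size (doubleCover (triangleStars σ)) ≤ (r + 2) ^ 3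
size-doubleCover-triangleStars {r} σ = begin
  size (triangleStars σ) + size (triangleStars σ)  ≤⟨ +-mono-≤ (size-triangleStars σ) (size-triangleStars σ) ⟩
  (r + 2) * (r + 2) + (r + 2) * (r + 2)            ≡⟨ cong ((r + 2) * (r + 2) +_) (+-identityʳ _) ⟨
  2 * ((r + 2) * (r + 2))                          ≤⟨ *-monoˡ-≤ ((r + 2) * (r + 2)) (m≤n+m 2 r) ⟩
  (r + 2) * ((r + 2) * (r + 2))                    ≡⟨ cong (λ x → (r + 2) * ((r + 2) * x)) (*-identityʳ (r + 2)) ⟨
  (r + 2) ^ 3                                      ∎
  where open ≤-Reasoning

hom-doubleCover-triangleStars≤ : ∀ F {r} (σ : Fin r → Bool) →
  hom F (doubleCover (triangleStars σ)) ≤ (r + 2) ^ (3 * size F)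
hom-doubleCover-triangleStars≤ F {r} σ = begin
  hom F (doubleCover (triangleStars σ))               ≤⟨ hom≤ F (doubleCover (triangleStars σ)) ⟩
  size (doubleCover (triangleStars σ)) ^ size F       ≤⟨ ^-monoˡ-≤ (size F) (size-doubleCover-triangleStars σ) ⟩
  ((r + 2) ^ 3) ^ size F                              ≡⟨ ^-*-assoc (r + 2) 3 (size F) ⟩
  (r + 2) ^ (3 * size F)                              ∎
  where open ≤-Reasoning

1+n≤2^n : ∀ n → suc n ≤ 2 ^ n
1+n≤2^n zero    = ≤-refl
1+n≤2^n (suc n) = +-mono-≤ (m^n>0 2 n) (≤-trans (1+n≤2^n n) (m≤m+n _ 0))

2+n≤n*4 : ∀ n → 0 < n → 2 + n ≤ n * 4
2+n≤n*4 (suc n) _ = s≤s (s≤s (s≤s (≤-trans (m≤m*n n 4) (n≤1+n _))))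

-- r = 2^(2c) with c = 2k + 1 is large enough: (r + 2)^k ≤ 2^((2c + 1) k) and (2c + 1) k + 2 ≤ (c + 1)² ≤ r.
poly<exp : ∀ k → ∃ λ r → suc ((r + 2) ^ k) < 2 ^ r
poly<exp k = r , (begin
  2 + (r + 2) ^ k        ≤⟨ +-monoʳ-≤ 2 (^-monoˡ-≤ k r+2≤2^[1+b]) ⟩
  2 + (2 ^ suc b) ^ k    ≡⟨ cong (2 +_) (^-*-assoc 2 (suc b) k) ⟩
  2 + 2 ^ e              ≤⟨ 2+n≤n*4 (2 ^ e) (m^n>0 2 e) ⟩
  2 ^ e * 2 ^ 2          ≡⟨ ^-distribˡ-+-* 2 e 2 ⟨
  2 ^ (e + 2)            ≤⟨ ^-monoʳ-≤ 2 e+2≤r ⟩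
  2 ^ r                  ∎)
  where
  open ≤-Reasoning
  c b e r : ℕ
  c = 2 * k + 1
  b = c + c
  e = suc b * k
  r = 2 ^ b
  r+2≤2^[1+b] : r + 2 ≤ 2 ^ suc b
  r+2≤2^[1+b] = +-monoʳ-≤ r (≤-trans (1+n≤2^n 1)
                  (≤-trans (^-monoʳ-≤ 2 (≤-trans (m≤n+m 1 (2 * k)) (m≤m+n c c))) (m≤m+n r 0)))
  e+2≤r : e + 2 ≤ r
  e+2≤r = begin
    e + 2                  ≤⟨ m≤m+n _ (5 * k + 2) ⟩
    e + 2 + (5 * k + 2)    ≡⟨ square k ⟩
    (c + 1) * (c + 1)      ≤⟨ *-mono-≤ c+1≤2^c c+1≤2^c ⟩
    2 ^ c * 2 ^ c          ≡⟨ ^-distribˡ-+-* 2 c c ⟨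
    r                      ∎
    where
    square : ∀ k → suc ((2 * k + 1) + (2 * k + 1)) * k + 2 + (5 * k + 2) ≡ (2 * k + 1 + 1) * (2 * k + 1 + 1)
    square = solve-∀
    c+1≤2^c : c + 1 ≤ 2 ^ c
    c+1≤2^c = subst (_≤ 2 ^ c) (+-comm 1 c) (1+n≤2^n c)

funToFin-cong : ∀ {m n} {f g : Fin m → Fin n} → f ≗ g → funToFin f ≡ funToFin g
funToFin-cong {zero}  f≗g = refl
funToFin-cong {suc m} f≗g = cong₂ combine (f≗g zero) (funToFin-cong (f≗g ∘ suc))

bits : ∀ {r} → Fin (2 ^ r) → Fin r → Bool
bits i = Inverse.to 2↔Bool ∘ finToFun i

bits-injective : ∀ {r} {i j : Fin (2 ^ r)} → bits {r} i ≗ bits {r} j → i ≡ j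
bits-injective {r} {i} {j} same = begin
  i                             ≡⟨ funToFin-finToFin {r} {2} i ⟨
  funToFin (finToFun {2} {r} i) ≡⟨ funToFin-cong (λ t → trans (sym (from-to t i))
                                     (trans (cong (Inverse.from 2↔Bool) (same t)) (from-to t j))) ⟩
  funToFin (finToFun {2} {r} j) ≡⟨ funToFin-finToFin {r} {2} j ⟩
  j                             ∎
  where
  open ≡-Reasoning
  from-to : ∀ t k → Inverse.from 2↔Bool (bits {r} k t) ≡ finToFun {2} {r} k t
  from-to t k = Inverse.strictlyInverseʳ 2↔Bool (finToFun {2} {r} k t)

-- Pigeonhole: 2^r double covers, but only polynomially many possible values of hom(F, -).
hom-collision : ∀ F → ∃ λ r → Σ (Fin r → Bool) λ σ → Σ (Fin r → Bool) λ τ →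
  ¬ σ ≗ τ × hom F (doubleCover (triangleStars σ)) ≡ hom F (doubleCover (triangleStars τ))
hom-collision F =
  let r , r-large = poly<exp (3 * size F)
      i , j , i<j , same = pigeonhole r-large (homValue r)
  in r , bits {r} i , bits {r} j , Fin.<⇒≢ i<j ∘ bits-injective {r} ,
     trans (sym (toℕ-fromℕ< _)) (trans (cong toℕ same) (toℕ-fromℕ< _))
  where
  homValue : ∀ r → Fin (2 ^ r) → Fin (suc ((r + 2) ^ (3 * size F)))
  homValue r i = fromℕ< (s≤s (hom-doubleCover-triangleStars≤ F (bits {r} i)))

Determines : Graph → (ℕ → Graph) → Set
Determines F N = ∀ G H → hom F G ≡ hom F H → hom (N (hom F G)) G ≡ hom (N (hom F G)) H → G ≅ H

¬Determines-nonbipartite : ∀ {F N} → hom F (complete 2) ≡ 0 → ¬ Determines F N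
¬Determines-nonbipartite {F} {N} F↛K₂ determines = by-cases (hom (N 0) (edgeless 1) ≟ 0)
  where
  edgeless-bipartite : ∀ n {{_ : NonZero n}} → Bipartite (edgeless n)
  edgeless-bipartite n = Edgeless⇒Hom (edgeless n) (edgeless-Edgeless n) (complete 2) zero

  separate : ∀ G H → Bipartite G → Bipartite H → hom (N 0) G ≡ hom (N 0) H → G ≅ H
  separate G H G-bip H-bip same =
    determines G H (trans F-G≡0 (sym (hom≡0-∘ F H-bip F↛K₂)))
                   (subst (λ n → hom (N n) G ≡ hom (N n) H) (sym F-G≡0) same)
    where
    F-G≡0 : hom F G ≡ 0
    F-G≡0 = hom≡0-∘ F G-bip F↛K₂

  by-cases : Dec (hom (N 0) (edgeless 1) ≡ 0) → ⊥
  by-cases (yes hom≡0) = case ≅⇒size≡ {edgeless 1} {edgeless 2} edgeless₁≅edgeless₂ of λ ()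
    where
    edgeless₁≅edgeless₂ : edgeless 1 ≅ edgeless 2
    edgeless₁≅edgeless₂ = separate (edgeless 1) (edgeless 2) (edgeless-bipartite 1) (edgeless-bipartite 2)
      (trans hom≡0 (sym (hom≡0-∘ (N 0) (Edgeless⇒Hom (edgeless 2) (edgeless-Edgeless 2) (edgeless 1) zero) hom≡0)))
  by-cases (no hom≢0) =
    Hom-Edgeless (≅⇒Hom⁻¹ {edgeless 2} {complete 2} edgeless₂≅K₂) (edgeless-Edgeless 2) zero (suc zero) _
    where
    N₀-edgeless : Edgeless (N 0)
    N₀-edgeless = Hom-Edgeless (hom-witness {N 0} {edgeless 1} (n≢0⇒n>0 hom≢0)) (edgeless-Edgeless 1)
    edgeless₂≅K₂ : edgeless 2 ≅ complete 2
    edgeless₂≅K₂ = separate (edgeless 2) (complete 2) (edgeless-bipartite 2) Hom-id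
      (trans (hom-Edgeless (N 0) (edgeless 2) N₀-edgeless) (sym (hom-Edgeless (N 0) (complete 2) N₀-edgeless)))

Determines⇒≗ : ∀ {F N} → Bipartite F → Determines F N → ∀ {r} (σ τ : Fin r → Bool) →
  hom F (doubleCover (triangleStars σ)) ≡ hom F (doubleCover (triangleStars τ)) → σ ≗ τ
Determines⇒≗ {F} {N} F-bip determines σ τ same =
  [ (λ K-bip → ⊥-elim (¬doubleCover≅⊕ (triangle-triangleStars σ)
                 (determines (doubleCover Xσ) (Xσ ⊕ Xσ) (hom-doubleCover Xσ F-bip) (hom-doubleCover Xσ K-bip))))
  , (λ K↛K₂ → doubleCover-triangleStars-≅ (determines (doubleCover Xσ) (doubleCover Xτ) same
                 (trans (hom≡0-∘ K (doubleCover-bipartite Xσ) K↛K₂)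
                        (sym (hom≡0-∘ K (doubleCover-bipartite Xτ) K↛K₂))))) ]
  (bipartite-or-hom≡0 K)
  where
  Xσ Xτ K : Graph
  Xσ = triangleStars σ
  Xτ = triangleStars τ
  K = N (hom F (doubleCover Xσ))

¬Determines-bipartite : ∀ {F N} → Bipartite F → ¬ Determines F N
¬Determines-bipartite {F} {N} F-bip determines =
  let _ , σ , τ , σ≉τ , same = hom-collision F in σ≉τ (Determines⇒≗ {F} {N} F-bip determines σ τ same)

corollary8p10 : ¬ (Σ Graph λ F → Σ (ℕ → Graph) λ N → ∀ G H → hom F G ≡ hom F H → hom (N (hom F G)) G ≡ hom (N (hom F G)) H → G ≅ H)
corollary8p10 (F , N , determines) =
  [ (λ F-bipartite → ¬Determines-bipartite {F} {N} F-bipartite determines)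
  , (λ F↛K₂ → ¬Determines-nonbipartite {F} {N} F↛K₂ determines) ] (bipartite-or-hom≡0 F)
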